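{- There is a positive existential formula $\theta_{CO}(m,n)$ in the language $\{0,1,+,\mid,R,T\}$ such that for every prime $p$ and all $m,n\in\mathbb{Z}$: $\mathfrak{D}_p\models\theta_{CO}(m,n)$ if and only if $p\nmid m$, $p\nmid n$ and $n=m^2$. That is, the collection of sets $\{(n,n^2)\colon n\in\mathbb{Z},\ p\nmid n\}$ is uniformly positive existentially definable in the class $\{\mathfrak{D}_p\colon p\text{ prime}\}$.
   Context: $\mathfrak{D}_p=(\mathbb{Z};0,1,+,\mid,\mid_p,\mathbb{Z}\smallsetminus\{ -1,0,1\})$, where $\mid$ is usual divisibility, $R$ is interpreted as $\mid_p$ (i.e. $x\mid_p y$ iff $y=\pm xp^s$ for some $s\in\mathbb{Z}$), and the unary symbol $T$ is interpreted as $\mathbb{Z}\smallsetminus\{ -1,0,1\}$. -}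

module Defs where

open import Data.Nat using (ℕ; zero; suc)
open import Data.Fin using (Fin)
open import Data.Integer using (ℤ; +_; -_; _+_; _*_; _^_; 0ℤ; 1ℤ; -1ℤ)
open import Data.Integer.Divisibility using (_∣_)
open import Data.Product using (Σ; _×_)
open import Data.Sum using (_⊎_)
open import Relation.Binary.PropositionalEquality using (_≡_)
open import Relation.Nullary using (¬_)

data Term (n : ℕ) : Set where
  var  : Fin n → Term n
  zer  : Term n
  one  : Term n
  _⊕_  : Term n → Term n → Term n

data PEFormula (n : ℕ) : Set where
  _≐_  : Term n → Term n → PEFormula n
  _∣'_ : Term n → Term n → PEFormula n
  Rel  : Term n → Term n → PEFormula n
  Tp   : Term n → PEFormula n
  _∧'_ : PEFormula n → PEFormula n → PEFormula n
  _∨'_ : PEFormula n → PEFormula n → PEFormula n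
  ∃'   : PEFormula (suc n) → PEFormula n

-- x ∣_p y  iff  y = ± x p^s for some s ∈ ℤ
-- (s ≥ 0: y = ± x p^s ; s < 0: x = ± y p^{-s})
_∣[_]_ : ℤ → ℕ → ℤ → Set
x ∣[ p ] y = Σ ℕ λ s →
  (y ≡ x * ((+ p) ^ s)) ⊎ (y ≡ - (x * ((+ p) ^ s)))
  ⊎ (x ≡ y * ((+ p) ^ s)) ⊎ (x ≡ - (y * ((+ p) ^ s)))

InT : ℤ → Set
InT x = ¬ (x ≡ -1ℤ) × ¬ (x ≡ 0ℤ) × ¬ (x ≡ 1ℤ)

Env : ℕ → Set
Env n = Fin n → ℤ

extend : ∀ {n} → ℤ → Env n → Env (suc n)
extend z ρ Fin.zero    = z
extend z ρ (Fin.suc i) = ρ i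

evalT : ∀ {n} → Env n → Term n → ℤ
evalT ρ (var i) = ρ i
evalT ρ zer     = 0ℤ
evalT ρ one     = 1ℤ
evalT ρ (s ⊕ t) = evalT ρ s + evalT ρ t

Sat : (p : ℕ) → ∀ {n} → Env n → PEFormula n → Set
Sat p ρ (s ≐ t)  = evalT ρ s ≡ evalT ρ t
Sat p ρ (s ∣' t) = evalT ρ s ∣ evalT ρ t
Sat p ρ (Rel s t) = evalT ρ s ∣[ p ] evalT ρ t
Sat p ρ (Tp t)   = InT (evalT ρ t)
Sat p ρ (φ ∧' ψ) = Sat p ρ φ × Sat p ρ ψ
Sat p ρ (φ ∨' ψ) = Sat p ρ φ ⊎ Sat p ρ ψ
Sat p ρ (∃' φ)   = Σ ℤ λ z → Sat p (extend z ρ) φ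

env2 : ℤ → ℤ → Env 2
env2 m n Fin.zero = m
env2 m n (Fin.suc _) = n

module Submission where

-- θ_CO(m, n) says: there are u, x′, Z, x, Y (and differences w₁,…,w₅, d) with
--   (1) u = ±p^s, s ≥ 1, and m, n ∣ u - 1;          so p ∤ m, n and |m|, |n| ≤ |u| + 1,
--   (2) 8u + 1 ∣_p x′ and u ∣ x′;                   so |x′| ≥ (8|u| - 1)|u|,
--   (3) Z = ±p^r, r ≥ 1, and x′ + 1 ∣ Z - 1;         so |Z - 1| ≳ 8|u|²,
--   (4) m ∣_p x and Z ∣ x, plus a gadget with Y = ±p^q, Z ∣ Y, Y ± Z ∈ T and x ∣ Y - Z
--       showing p^(r+1) ∤ x;                         so x = ±mZ,
--   (5) Z - m ∣ n - x and Z - 1 ∣ x - m;             so, Z being large, x = mZ and n = m².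
-- Conversely, for p ∤ m and n = m² the witnesses are powers of p chosen as multiplicative
-- orders of p modulo n, x′ + 1 and m.

open import Defs
open import Data.Nat as ℕ using (ℕ; zero; suc; z≤n; s≤s)
open import Data.Product using (Σ; Σ-syntax; _×_; _,_)
open import Data.Sum using (_⊎_; inj₁; inj₂)
open import Data.Empty using (⊥; ⊥-elim)
open import Relation.Nullary using (¬_)
open import Relation.Binary.PropositionalEquality
open import Data.Nat.Primality using (Prime; prime⇒nonZero; prime⇒nonTrivial; prime⇒irreducible)
open import Function.Bundles using (_⇔_; mk⇔)

module Formula where
  open import Data.Fin using (#_)

  -- The variables of the matrix, numbered from the innermost quantifier outwards;
  -- m and n are the free variables.
  w₅ w₄ d w₃ w₂ w₁ Y x Z x′ u m n : Term 13
  w₅ = var (# 0)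
  w₄ = var (# 1)
  d  = var (# 2)
  w₃ = var (# 3)
  w₂ = var (# 4)
  w₁ = var (# 5)
  Y  = var (# 6)
  x  = var (# 7)
  Z  = var (# 8)
  x′ = var (# 9)
  u  = var (# 10)
  m  = var (# 11)
  n  = var (# 12)

  8u+1 : Term 13
  8u+1 = ((((((((u ⊕ u) ⊕ u) ⊕ u) ⊕ u) ⊕ u) ⊕ u) ⊕ u) ⊕ one)

  infixr 4 _&_
  _&_ : ∀ {k} → PEFormula k → PEFormula k → PEFormula k
  _&_ = _∧'_

  matrix : PEFormula 13
  matrix =
    Rel one u & Tp u & (u ≐ (w₁ ⊕ one)) & (m ∣' w₁) & (n ∣' w₁) &
    Rel 8u+1 x′ & (u ∣' x′) &
    Rel one Z & Tp Z & (Z ≐ (w₂ ⊕ one)) & ((x′ ⊕ one) ∣' w₂) &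
    Rel m x & (Z ∣' x) &
    Rel one Y & (Z ∣' Y) & (Y ≐ (w₃ ⊕ Z)) & Tp (Y ⊕ Z) & Tp w₃ & (x ∣' w₃) &
    (Z ≐ (d ⊕ m)) & (n ≐ (w₄ ⊕ x)) & (d ∣' w₄) &
    (x ≐ (w₅ ⊕ m)) & (w₂ ∣' w₅)

  θ-CO : PEFormula 2
  θ-CO = ∃' (∃' (∃' (∃' (∃' (∃' (∃' (∃' (∃' (∃' (∃' matrix))))))))))

open Formula using (θ-CO)

module Residues where
  open import Data.Nat
  open import Data.Nat.Properties
  open import Data.Nat.Divisibility
  open import Data.Nat.DivMod

  %-≡⇒∣∸ : ∀ c a b .{{_ : NonZero c}} → a % c ≡ b % c → c ∣ b ∸ a
  %-≡⇒∣∸ c a b e = divides (b / c ∸ a / c) (begin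
      b ∸ a                                     ≡⟨ cong₂ _∸_ (m≡m%n+[m/n]*n b c) (m≡m%n+[m/n]*n a c) ⟩
      (b % c + b / c * c) ∸ (a % c + a / c * c) ≡⟨ cong (λ r → (b % c + b / c * c) ∸ (r + a / c * c)) e ⟩
      (b % c + b / c * c) ∸ (b % c + a / c * c) ≡⟨ [m+n]∸[m+o]≡n∸o (b % c) _ _ ⟩
      b / c * c ∸ a / c * c                     ≡⟨ *-distribʳ-∸ c (b / c) (a / c) ⟨
      (b / c ∸ a / c) * c                       ∎)
    where open ≡-Reasoning

module PrimePowers {p : ℕ} (p-prime : Prime p) where
  open import Data.Nat
  open import Data.Nat.Properties
  open import Data.Nat.Divisibility
  open import Data.Nat.DivMod using (_mod_)
  open import Data.Nat.Coprimality using (Coprime; coprime-divisor)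
  open import Data.Fin using (Fin; toℕ)
  open import Data.Fin.Properties using (pigeonhole; toℕ-fromℕ<)
  open import Algebra.Properties.CommutativeSemigroup *-commutativeSemigroup using (x∙yz≈y∙xz)
  open Residues

  instance
    p-nonZero : NonZero p
    p-nonZero = prime⇒nonZero p-prime

  p≥2 : 2 ≤ p
  p≥2 = nonTrivial⇒n>1 p {{prime⇒nonTrivial p-prime}}

  p∤1 : ¬ p ∣ 1
  p∤1 p∣1 = <⇒≢ p≥2 (sym (∣1⇒≡1 p∣1))

  p∣p^s : ∀ {s} → 1 ≤ s → p ∣ p ^ s
  p∣p^s {suc s} _ = m∣m*n (p ^ s)

  p^-mono-∣ : ∀ {s t} → s ≤ t → p ^ s ∣ p ^ t
  p^-mono-∣ {s} {t} s≤t = divides (p ^ (t ∸ s)) (begin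
    p ^ t               ≡⟨ cong (p ^_) (m+[n∸m]≡n s≤t) ⟨
    p ^ (s + (t ∸ s))   ≡⟨ ^-distribˡ-+-* p s (t ∸ s) ⟩
    p ^ s * p ^ (t ∸ s) ≡⟨ *-comm (p ^ s) _ ⟩
    p ^ (t ∸ s) * p ^ s ∎)
    where open ≡-Reasoning

  valuation-bound : ∀ {a} s t → ¬ p ∣ a → p ^ s ∣ a * p ^ t → s ≤ t
  valuation-bound zero    t       p∤a _ = z≤n
  valuation-bound (suc s) zero    p∤a h =
    ⊥-elim (p∤a (∣-trans (m∣m*n (p ^ s)) (subst (p ^ suc s ∣_) (*-identityʳ _) h)))
  valuation-bound {a} (suc s) (suc t) p∤a h =
    s≤s (valuation-bound s t p∤a (*-cancelˡ-∣ p (subst (p * p ^ s ∣_) (x∙yz≈y∙xz a p (p ^ t)) h)))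

  p^s∣p^t⇒s≤t : ∀ s t → p ^ s ∣ p ^ t → s ≤ t
  p^s∣p^t⇒s≤t s t h = valuation-bound s t p∤1 (subst (p ^ s ∣_) (sym (*-identityˡ (p ^ t))) h)

  -- A number not divisible by p is coprime to p, so it cancels against powers of p.
  cancel-p^ : ∀ {c} i o → ¬ p ∣ c → c ∣ p ^ i * o → c ∣ o
  cancel-p^ zero    o p∤c h = subst (_ ∣_) (+-identityʳ o) h
  cancel-p^ {c} (suc i) o p∤c h =
    cancel-p^ i o p∤c (coprime-divisor coprime (subst (c ∣_) (*-assoc p (p ^ i) o) h))
    where
    coprime : Coprime c p
    coprime (d∣c , d∣p) with prime⇒irreducible p-prime d∣p
    ... | inj₁ d≡1 = d≡1
    ... | inj₂ refl = ⊥-elim (p∤c d∣c)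

  -- p has a multiplicative order modulo every c with p ∤ c: by pigeonhole two of
  -- p⁰, …, p^c agree modulo c, and the common power of p cancels.
  multiplicative-order : ∀ {c} → ¬ p ∣ c → Σ[ k ∈ ℕ ] 1 ≤ k × c ∣ p ^ k ∸ 1
  multiplicative-order {zero} p∤0 = ⊥-elim (p∤0 (p ∣0))
  multiplicative-order {c@(suc _)} p∤c
    with pigeonhole (n<1+n c) (λ (i : Fin (suc c)) → p ^ toℕ i mod c)
  ... | i , j , i<j , same-residue = k , m<n⇒0<n∸m i<j , cancel-p^ (toℕ i) (p ^ k ∸ 1) p∤c c∣p^i[p^k∸1]
    where
    open ≡-Reasoning
    k = toℕ j ∸ toℕ i
    p^j≡p^i*p^k : p ^ toℕ j ≡ p ^ toℕ i * p ^ k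
    p^j≡p^i*p^k = trans (cong (p ^_) (sym (m+[n∸m]≡n (<⇒≤ i<j)))) (^-distribˡ-+-* p (toℕ i) k)
    c∣p^i[p^k∸1] : c ∣ p ^ toℕ i * (p ^ k ∸ 1)
    c∣p^i[p^k∸1] = subst (c ∣_) (begin
        p ^ toℕ j ∸ p ^ toℕ i                   ≡⟨ cong₂ _∸_ p^j≡p^i*p^k (sym (*-identityʳ (p ^ toℕ i))) ⟩
        p ^ toℕ i * p ^ k ∸ p ^ toℕ i * 1       ≡⟨ *-distribˡ-∸ (p ^ toℕ i) (p ^ k) 1 ⟨
        p ^ toℕ i * (p ^ k ∸ 1)                 ∎)
      (%-≡⇒∣∸ c (p ^ toℕ i) (p ^ toℕ j)
        (trans (sym (toℕ-fromℕ< _)) (trans (cong toℕ same-residue) (toℕ-fromℕ< _))))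

module Arithmetic where
  open import Data.Nat
  open import Data.Nat.Properties
  open import Data.Nat.Tactic.RingSolver using (solve-∀)

  -- For U ≥ 2 the number 8U² exceeds (U + 2)² + 1 + U, so W ≤ (U + 2)² and
  -- 8U² ≤ W + 1 + U cannot hold together.
  quadratic-gap : ∀ U W → 2 ≤ U → 8 * U * U ≤ W + 1 + U → W ≤ (U + 2) * (U + 2) → ⊥
  quadratic-gap 1 W (s≤s ())
  quadratic-gap U@(suc (suc V)) W _ large W-small = m+1+n≰m ((U + 2) * (U + 2) + 1 + U) (begin
    (U + 2) * (U + 2) + 1 + U + suc (7 * V * V + 23 * V + 12) ≡⟨ expand V ⟩
    8 * U * U                                                 ≤⟨ large ⟩
    W + 1 + U                                                 ≤⟨ +-monoˡ-≤ U (+-monoˡ-≤ 1 W-small) ⟩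
    (U + 2) * (U + 2) + 1 + U                                 ∎)
    where
    open ≤-Reasoning
    expand : ∀ V → (suc (suc V) + 2) * (suc (suc V) + 2) + 1 + suc (suc V) + suc (7 * V * V + 23 * V + 12)
                   ≡ 8 * suc (suc V) * suc (suc V)
    expand = solve-∀

open import Data.Integer using (ℤ; +_; -_; _+_; _-_; _*_; _^_; ∣_∣; 0ℤ; 1ℤ; -[1+_]; +[1+_])
open import Data.Integer.Properties
open import Data.Integer.Divisibility using (_∣_; *-monoˡ-∣)
import Data.Integer.Divisibility.Signed as Signed
open import Data.Integer.Tactic.RingSolver using (solve-∀)
import Data.Nat.Properties as ℕP
import Data.Nat.Divisibility as ℕD
import Data.Nat.Tactic.RingSolver as ℕSolver
open import Relation.Nullary using (yes; no)

module IntegerFacts where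

  infix 4 _≡±_
  _≡±_ : ℤ → ℤ → Set
  x ≡± y = x ≡ y ⊎ x ≡ - y

  ∣∣≡⇒≡± : ∀ x y → ∣ x ∣ ≡ ∣ y ∣ → x ≡± y
  ∣∣≡⇒≡± (+ m)    (+ n)    e    = inj₁ (cong +_ e)
  ∣∣≡⇒≡± (+ zero) -[1+ n ] ()
  ∣∣≡⇒≡± +[1+ m ] -[1+ n ] refl = inj₂ refl
  ∣∣≡⇒≡± -[1+ m ] (+ n)    refl = inj₂ refl
  ∣∣≡⇒≡± -[1+ m ] -[1+ n ] refl = inj₁ refl

  ≡±⇒∣∣≡ : ∀ {x y} → x ≡± y → ∣ x ∣ ≡ ∣ y ∣
  ≡±⇒∣∣≡ (inj₁ refl) = refl
  ≡±⇒∣∣≡ {y = y} (inj₂ refl) = ∣-i∣≡∣i∣ y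

  ≡±-replace : ∀ {x m q z} → x ≡± m * q → z ≡± q → x ≡± m * z
  ≡±-replace (inj₁ x≡) (inj₁ refl) = inj₁ x≡
  ≡±-replace (inj₂ x≡) (inj₁ refl) = inj₂ x≡
  ≡±-replace {m = m} {q} (inj₁ x≡) (inj₂ refl) = inj₂ (trans x≡ (sym (flip m q)))
    where flip : ∀ m q → - (m * (- q)) ≡ m * q
          flip = solve-∀
  ≡±-replace {m = m} {q} (inj₂ x≡) (inj₂ refl) = inj₁ (trans x≡ (neg-distribʳ-* m q))

  InT⇒2≤∣∣ : ∀ {z} → InT z → 2 ℕ.≤ ∣ z ∣
  InT⇒2≤∣∣ {+ zero}          (_ , z≢0 , _) = ⊥-elim (z≢0 refl)
  InT⇒2≤∣∣ {+ suc zero}      (_ , _ , z≢1) = ⊥-elim (z≢1 refl)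
  InT⇒2≤∣∣ {+ suc (suc _)}   _             = s≤s (s≤s z≤n)
  InT⇒2≤∣∣ { -[1+ zero ] }   (z≢-1 , _)    = ⊥-elim (z≢-1 refl)
  InT⇒2≤∣∣ { -[1+ suc _ ] }  _             = s≤s (s≤s z≤n)

  2≤∣∣⇒InT : ∀ {z} → 2 ℕ.≤ ∣ z ∣ → InT z
  2≤∣∣⇒InT 2≤∣z∣ = (λ { refl → 2≰1 2≤∣z∣ }) , (λ { refl → 2≰0 2≤∣z∣ }) , (λ { refl → 2≰1 2≤∣z∣ })
    where 2≰1 : ¬ 2 ℕ.≤ 1
          2≰1 = ℕP.<-irrefl refl
          2≰0 : ¬ 2 ℕ.≤ 0
          2≰0 ()

  InT⇒≢0 : ∀ {z} → InT z → z ≢ 0ℤ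
  InT⇒≢0 (_ , z≢0 , _) = z≢0

  InT-* : ∀ {a b} → InT a → b ≢ 0ℤ → InT (a * b)
  InT-* {a} {b} a∈T b≢0 = 2≤∣∣⇒InT (subst (2 ℕ.≤_) (sym (abs-* a b))
    (ℕP.*-mono-≤ (InT⇒2≤∣∣ a∈T) (ℕP.n≢0⇒n>0 (λ ∣b∣≡0 → b≢0 (∣i∣≡0⇒i≡0 ∣b∣≡0)))))

  InT⇒pred≢0 : ∀ {a} → InT a → a - 1ℤ ≢ 0ℤ
  InT⇒pred≢0 {a} (_ , _ , a≢1) e = a≢1 (trans (sym (shift a)) (cong (_+ 1ℤ) e))
    where shift : ∀ a → (a - 1ℤ) + 1ℤ ≡ a
          shift = solve-∀

  InT⇒suc≢0 : ∀ {a} → InT a → a + 1ℤ ≢ 0ℤ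
  InT⇒suc≢0 {a} (a≢-1 , _) e = a≢-1 (trans (sym (shift a)) (cong (_- 1ℤ) e))
    where shift : ∀ a → (a + 1ℤ) - 1ℤ ≡ a
          shift = solve-∀

  ≡+⇒-≡ : ∀ {a} w b → a ≡ w + b → a - b ≡ w
  ≡+⇒-≡ w b refl = cancel w b
    where cancel : ∀ w b → (w + b) - b ≡ w
          cancel = solve-∀

  -+-cancel : ∀ a b → a ≡ (a - b) + b
  -+-cancel = solve-∀

  ∣a∣≤∣a+1∣+1 : ∀ a → ∣ a ∣ ℕ.≤ ∣ a + 1ℤ ∣ ℕ.+ 1
  ∣a∣≤∣a+1∣+1 a = subst (λ z → ∣ z ∣ ℕ.≤ ∣ a + 1ℤ ∣ ℕ.+ 1) (≡+⇒-≡ a 1ℤ refl) (∣i-j∣≤∣i∣+∣j∣ (a + 1ℤ) 1ℤ)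

  ∣-bound : ∀ {a b} → a ∣ b → b ≢ 0ℤ → ∣ a ∣ ℕ.≤ ∣ b ∣
  ∣-bound a∣b b≢0 = ℕD.∣⇒≤ {{ℕ.≢-nonZero (λ ∣b∣≡0 → b≢0 (∣i∣≡0⇒i≡0 ∣b∣≡0))}} a∣b

  m∣m*n : ∀ m n → m ∣ m * n
  m∣m*n m n = ℕD.divides ∣ n ∣ (trans (abs-* m n) (ℕP.*-comm ∣ m ∣ ∣ n ∣))

  n∣m*n : ∀ m n → n ∣ m * n
  n∣m*n m n = ℕD.divides ∣ m ∣ (abs-* m n)

  ∣-sub : ∀ {k} a b → k ∣ a → k ∣ b → k ∣ a - b
  ∣-sub {k} a b k∣a k∣b =
    Signed.∣⇒∣ᵤ (Signed.∣m∣n⇒∣m-n (Signed.∣ᵤ⇒∣ {k} {a} k∣a) (Signed.∣ᵤ⇒∣ {k} {b} k∣b))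

  divisor-of-pred-bound : ∀ u c → InT u → c ∣ u - 1ℤ → ∣ c ∣ ℕ.≤ ∣ u ∣ ℕ.+ 1
  divisor-of-pred-bound u c u∈T c∣u-1 = ℕP.≤-trans (∣-bound {c} c∣u-1 (InT⇒pred≢0 u∈T)) (∣i-j∣≤∣i∣+∣j∣ u 1ℤ)

open IntegerFacts

module PowerRelation (p : ℕ) where

  +p^s≡+[p^s] : ∀ s → (+ p) ^ s ≡ + (p ℕ.^ s)
  +p^s≡+[p^s] zero    = refl
  +p^s≡+[p^s] (suc s) = trans (cong (+ p *_) (+p^s≡+[p^s] s)) (sym (pos-* p (p ℕ.^ s)))

  ∣p^s∣ : ∀ s → ∣ (+ p) ^ s ∣ ≡ p ℕ.^ s
  ∣p^s∣ s = cong ∣_∣ (+p^s≡+[p^s] s)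

  ∣a*p^t∣ : ∀ a t → ∣ a * (+ p) ^ t ∣ ≡ ∣ a ∣ ℕ.* p ℕ.^ t
  ∣a*p^t∣ a t = trans (abs-* a ((+ p) ^ t)) (cong (∣ a ∣ ℕ.*_) (∣p^s∣ t))

  ∣[p]-cases : ∀ {a x} → a ∣[ p ] x → (Σ[ t ∈ ℕ ] x ≡± a * (+ p) ^ t) ⊎ x ∣ a
  ∣[p]-cases         (t , inj₁ x≡)         = inj₁ (t , inj₁ x≡)
  ∣[p]-cases         (t , inj₂ (inj₁ x≡))  = inj₁ (t , inj₂ x≡)
  ∣[p]-cases {x = x} (t , inj₂ (inj₂ a≡±)) =
    inj₂ (ℕD.divides (p ℕ.^ t) (trans (≡±⇒∣∣≡ a≡±) (trans (∣a*p^t∣ x t) (ℕP.*-comm ∣ x ∣ _))))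

  power-of-p : ∀ {y} → 1ℤ ∣[ p ] y → Σ[ q ∈ ℕ ] ∣ y ∣ ≡ p ℕ.^ q
  power-of-p r with ∣[p]-cases r
  ... | inj₁ (q , y≡±) = q , trans (≡±⇒∣∣≡ y≡±) (trans (∣a*p^t∣ 1ℤ q) (ℕP.*-identityˡ _))
  ... | inj₂ y∣1       = 0 , ℕD.∣1⇒≡1 y∣1

  -- Requiring moreover y ∈ T excludes p⁰ = 1.
  proper-power : ∀ {u} → 1ℤ ∣[ p ] u → InT u → Σ[ s ∈ ℕ ] 1 ℕ.≤ s × ∣ u ∣ ≡ p ℕ.^ s
  proper-power r u∈T with power-of-p r
  ... | zero  , ∣u∣≡1 = ⊥-elim (ℕP.<-irrefl refl (subst (2 ℕ.≤_) ∣u∣≡1 (InT⇒2≤∣∣ u∈T)))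
  ... | suc s , ∣u∣≡p^s = suc s , s≤s z≤n , ∣u∣≡p^s

module PrimePowerRelation {p : ℕ} (p-prime : Prime p) where
  open PrimePowers p-prime
  open PowerRelation p

  exponent-bound : ∀ a x s → ¬ p ℕD.∣ ∣ a ∣ → 1 ℕ.≤ s → a ∣[ p ] x → p ℕ.^ s ℕD.∣ ∣ x ∣ →
                   Σ[ t ∈ ℕ ] s ℕ.≤ t × x ≡± a * (+ p) ^ t
  exponent-bound a x s p∤a 1≤s r p^s∣x with ∣[p]-cases r
  ... | inj₁ (t , x≡±) =
    t , valuation-bound s t p∤a (subst (_ ℕD.∣_) (trans (≡±⇒∣∣≡ x≡±) (∣a*p^t∣ a t)) p^s∣x) , x≡±
  ... | inj₂ x∣a = ⊥-elim (p∤a (ℕD.∣-trans (p∣p^s 1≤s) (ℕD.∣-trans p^s∣x x∣a)))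

  no-consecutive : ∀ a → + p ∣ a → + p ∣ a + 1ℤ → ⊥
  no-consecutive a p∣a p∣a+1 = p∤1 (subst (+ p ∣_) (difference a) (∣-sub {+ p} (a + 1ℤ) a p∣a+1 p∣a))
    where difference : ∀ a → (a + 1ℤ) - a ≡ 1ℤ
          difference = solve-∀

  p∤divisor-of-pred : ∀ u c → p ℕD.∣ ∣ u ∣ → c ∣ u - 1ℤ → ¬ p ℕD.∣ ∣ c ∣
  p∤divisor-of-pred u c p∣u c∣u-1 p∣c =
    no-consecutive (u - 1ℤ) (ℕD.∣-trans p∣c c∣u-1) (subst (λ k → p ℕD.∣ ∣ k ∣) (-+-cancel u 1ℤ) p∣u)

  order : ∀ c → ¬ (+ p ∣ c) → Σ[ k ∈ ℕ ] 1 ℕ.≤ k × c ∣ (+ p) ^ k - 1ℤ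
  order c p∤c with multiplicative-order p∤c
  ... | k , 1≤k , c∣p^k∸1 = k , 1≤k , subst (_ ℕD.∣_) (sym ∣p^k-1∣) c∣p^k∸1
    where
    ∣p^k-1∣ : ∣ (+ p) ^ k - 1ℤ ∣ ≡ p ℕ.^ k ℕ.∸ 1
    ∣p^k-1∣ = cong ∣_∣ (trans (cong (_- 1ℤ) (+p^s≡+[p^s] k))
                        (trans (m-n≡m⊖n (p ℕ.^ k) 1) (⊖-≥ (ℕP.m^n>0 p k))))

  power-InT : ∀ {s} → 1 ℕ.≤ s → InT ((+ p) ^ s)
  power-InT {s} 1≤s = 2≤∣∣⇒InT (subst (2 ℕ.≤_) (sym (∣p^s∣ s))
    (ℕP.≤-trans p≥2 (ℕD.∣⇒≤ {{ℕP.m^n≢0 p s}} (p∣p^s 1≤s))))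

module Gadgets {p : ℕ} (p-prime : Prime p) where
  open PrimePowers p-prime
  open PowerRelation p
  open PrimePowerRelation p-prime
  open Arithmetic
  open ℕP.≤-Reasoning

  -- If |Z| = p^r and Y = ±p^q is a multiple of Z different from ±Z, then q > r;
  -- hence a divisor x of Y - Z cannot contain p^(r+1), as then p^(r+1) would divide Z.
  power-gap : ∀ Z Y x r → ∣ Z ∣ ≡ p ℕ.^ r → 1ℤ ∣[ p ] Y → Z ∣ Y →
              Y + Z ≢ 0ℤ → Y - Z ≢ 0ℤ → x ∣ Y - Z → ¬ p ℕ.^ suc r ℕD.∣ ∣ x ∣
  power-gap Z Y x r ∣Z∣≡p^r Y-power Z∣Y Y+Z≢0 Y-Z≢0 x∣Y-Z p^r+1∣x with power-of-p Y-power
  ... | q , ∣Y∣≡p^q = ℕP.<-irrefl refl (p^s∣p^t⇒s≤t (suc r) r (subst (_ ℕD.∣_) ∣Z∣≡p^r p^r+1∣Z))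
    where
    r≤q : r ℕ.≤ q
    r≤q = p^s∣p^t⇒s≤t r q (subst₂ ℕD._∣_ ∣Z∣≡p^r ∣Y∣≡p^q Z∣Y)
    r≢q : r ≢ q
    r≢q refl with ∣∣≡⇒≡± Y Z (trans ∣Y∣≡p^q (sym ∣Z∣≡p^r))
    ... | inj₁ refl = Y-Z≢0 (+-inverseʳ Y)
    ... | inj₂ refl = Y+Z≢0 (+-inverseˡ Z)
    p^r+1∣Y : p ℕ.^ suc r ℕD.∣ ∣ Y ∣
    p^r+1∣Y = subst (_ ℕD.∣_) (sym ∣Y∣≡p^q) (p^-mono-∣ (ℕP.≤∧≢⇒< r≤q r≢q))
    Y-[Y-Z]≡Z : ∀ Y Z → Y - (Y - Z) ≡ Z
    Y-[Y-Z]≡Z = solve-∀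
    p^r+1∣Z : p ℕ.^ suc r ℕD.∣ ∣ Z ∣
    p^r+1∣Z = subst (λ z → p ℕ.^ suc r ℕD.∣ ∣ z ∣) (Y-[Y-Z]≡Z Y Z)
                (∣-sub {+ (p ℕ.^ suc r)} Y (Y - Z) p^r+1∣Y (ℕD.∣-trans p^r+1∣x x∣Y-Z))

  p∤8u+1 : ∀ u → p ℕD.∣ ∣ u ∣ → ¬ p ℕD.∣ ∣ + 8 * u + 1ℤ ∣
  p∤8u+1 u p∣u = no-consecutive (+ 8 * u) (ℕD.∣-trans p∣u (n∣m*n (+ 8) u))

  multiple-size : ∀ u x′ s → ∣ u ∣ ≡ p ℕ.^ s → 1 ℕ.≤ s →
    (+ 8 * u + 1ℤ) ∣[ p ] x′ → u ∣ x′ → ∣ + 8 * u + 1ℤ ∣ ℕ.* ∣ u ∣ ℕ.≤ ∣ x′ ∣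
  multiple-size u x′ s ∣u∣≡p^s 1≤s x′-power u∣x′
    with exponent-bound (+ 8 * u + 1ℤ) x′ s (p∤8u+1 u (subst (p ℕD.∣_) (sym ∣u∣≡p^s) (p∣p^s 1≤s))) 1≤s x′-power
                          (subst (ℕD._∣ ∣ x′ ∣) ∣u∣≡p^s u∣x′)
  ... | t , s≤t , x′≡± = begin
    ∣ A ∣ ℕ.* ∣ u ∣     ≡⟨ cong (∣ A ∣ ℕ.*_) ∣u∣≡p^s ⟩
    ∣ A ∣ ℕ.* p ℕ.^ s   ≤⟨ ℕP.*-monoʳ-≤ ∣ A ∣ (ℕP.^-monoʳ-≤ p {{p-nonZero}} s≤t) ⟩
    ∣ A ∣ ℕ.* p ℕ.^ t   ≡⟨ trans (≡±⇒∣∣≡ x′≡±) (∣a*p^t∣ A t) ⟨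
    ∣ x′ ∣              ∎
    where A = + 8 * u + 1ℤ

  multiple-is-large : ∀ u x′ w s → ∣ u ∣ ≡ p ℕ.^ s → 1 ℕ.≤ s →
    (+ 8 * u + 1ℤ) ∣[ p ] x′ → u ∣ x′ → x′ + 1ℤ ∣ w → w ≢ 0ℤ →
    8 ℕ.* ∣ u ∣ ℕ.* ∣ u ∣ ℕ.≤ ∣ w ∣ ℕ.+ 1 ℕ.+ ∣ u ∣
  multiple-is-large u x′ w s ∣u∣≡p^s 1≤s x′-power u∣x′ x′+1∣w w≢0 = begin
    8 ℕ.* U ℕ.* U               ≡⟨ cong (ℕ._* U) (abs-* (+ 8) u) ⟨
    ∣ + 8 * u ∣ ℕ.* U           ≤⟨ ℕP.*-monoˡ-≤ U (∣a∣≤∣a+1∣+1 (+ 8 * u)) ⟩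
    (∣ A ∣ ℕ.+ 1) ℕ.* U         ≡⟨ ℕP.*-distribʳ-+ U ∣ A ∣ 1 ⟩
    ∣ A ∣ ℕ.* U ℕ.+ 1 ℕ.* U     ≤⟨ ℕP.+-mono-≤ (multiple-size u x′ s ∣u∣≡p^s 1≤s x′-power u∣x′) (ℕP.≤-reflexive (ℕP.*-identityˡ U)) ⟩
    ∣ x′ ∣ ℕ.+ U                ≤⟨ ℕP.+-monoˡ-≤ U (∣a∣≤∣a+1∣+1 x′) ⟩
    ∣ x′ + 1ℤ ∣ ℕ.+ 1 ℕ.+ U     ≤⟨ ℕP.+-monoˡ-≤ U (ℕP.+-monoˡ-≤ 1 (∣-bound {x′ + 1ℤ} x′+1∣w w≢0)) ⟩
    ∣ w ∣ ℕ.+ 1 ℕ.+ U           ∎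
    where
    U = ∣ u ∣
    A = + 8 * u + 1ℤ

  exact-multiple : ∀ m x Z r → ∣ Z ∣ ≡ p ℕ.^ r → 1 ℕ.≤ r → ¬ p ℕD.∣ ∣ m ∣ →
                   m ∣[ p ] x → Z ∣ x → ¬ p ℕ.^ suc r ℕD.∣ ∣ x ∣ → x ≡± m * Z
  exact-multiple m x Z r ∣Z∣≡p^r 1≤r p∤m x-power Z∣x p^r+1∤x
    with exponent-bound m x r p∤m 1≤r x-power (subst (ℕD._∣ ∣ x ∣) ∣Z∣≡p^r Z∣x)
  ... | t , r≤t , x≡± = ≡±-replace {m = m} (subst (λ k → x ≡± m * (+ p) ^ k) t≡r x≡±) Z≡±p^r
    where
    t≤r : t ℕ.≤ r
    t≤r = ℕP.≮⇒≥ λ r<t → p^r+1∤x (subst (_ ℕD.∣_) (sym (trans (≡±⇒∣∣≡ x≡±) (∣a*p^t∣ m t)))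
                                     (ℕD.∣n⇒∣m*n ∣ m ∣ (p^-mono-∣ r<t)))
    t≡r : t ≡ r
    t≡r = ℕP.≤-antisym t≤r r≤t
    Z≡±p^r : Z ≡± (+ p) ^ r
    Z≡±p^r = ∣∣≡⇒≡± Z ((+ p) ^ r) (trans ∣Z∣≡p^r (sym (∣p^s∣ r)))

  -- The final step: once |Z - 1| is of size about 8U² while |m|, |n| ≤ U + 1, the
  -- conditions Z - m ∣ n - x and Z - 1 ∣ x - m leave only x = m·Z and n = m².
  -- (If x = m·Z then Z - m ∣ n - m², and if x = -m·Z then Z - 1 ∣ 2m; either
  -- divisibility with a nonzero right-hand side would make |Z - 1| ≤ (U+2)².)
  forced-square : ∀ m n Z x U → 2 ℕ.≤ U → ∣ m ∣ ℕ.≤ U ℕ.+ 1 → ∣ n ∣ ℕ.≤ U ℕ.+ 1 → m ≢ 0ℤ →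
    8 ℕ.* U ℕ.* U ℕ.≤ ∣ Z - 1ℤ ∣ ℕ.+ 1 ℕ.+ U →
    Z - m ∣ n - x → Z - 1ℤ ∣ x - m → x ≡± m * Z → n ≡ m * m
  forced-square m n Z .(m * Z) U 2≤U ∣m∣≤ ∣n∣≤ m≢0 large Z-m∣n-x _ (inj₁ refl)
    with n - m * m ≟ 0ℤ
  ... | yes n-m²≡0 = trans (-+-cancel n (m * m)) (trans (cong (_+ m * m) n-m²≡0) (+-identityˡ (m * m)))
  ... | no  n-m²≢0 = ⊥-elim (quadratic-gap U ∣ Z - 1ℤ ∣ 2≤U large ∣Z-1∣≤)
    where
    rearrange : ∀ n m Z → (n - m * Z) - (- m) * (Z - m) ≡ n - m * m
    rearrange = solve-∀
    Z-m∣n-m² : Z - m ∣ n - m * m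
    Z-m∣n-m² = subst (λ k → Z - m ∣ k) (rearrange n m Z)
                 (∣-sub {Z - m} (n - m * Z) ((- m) * (Z - m)) Z-m∣n-x (n∣m*n (- m) (Z - m)))
    ∣Z-m∣≤ : ∣ Z - m ∣ ℕ.≤ (U ℕ.+ 1) ℕ.+ (U ℕ.+ 1) ℕ.* (U ℕ.+ 1)
    ∣Z-m∣≤ = begin
      ∣ Z - m ∣                      ≤⟨ ∣-bound {Z - m} Z-m∣n-m² n-m²≢0 ⟩
      ∣ n - m * m ∣                  ≤⟨ ∣i-j∣≤∣i∣+∣j∣ n (m * m) ⟩
      ∣ n ∣ ℕ.+ ∣ m * m ∣            ≡⟨ cong (∣ n ∣ ℕ.+_) (abs-* m m) ⟩
      ∣ n ∣ ℕ.+ ∣ m ∣ ℕ.* ∣ m ∣      ≤⟨ ℕP.+-mono-≤ ∣n∣≤ (ℕP.*-mono-≤ ∣m∣≤ ∣m∣≤) ⟩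
      (U ℕ.+ 1) ℕ.+ (U ℕ.+ 1) ℕ.* (U ℕ.+ 1) ∎
    split : ∀ Z m → Z - 1ℤ ≡ (Z - m) + (m - 1ℤ)
    split = solve-∀
    square : ∀ U → ((U ℕ.+ 1) ℕ.+ (U ℕ.+ 1) ℕ.* (U ℕ.+ 1)) ℕ.+ (U ℕ.+ 1 ℕ.+ 1) ≡ (U ℕ.+ 2) ℕ.* (U ℕ.+ 2)
    square = ℕSolver.solve-∀
    ∣Z-1∣≤ : ∣ Z - 1ℤ ∣ ℕ.≤ (U ℕ.+ 2) ℕ.* (U ℕ.+ 2)
    ∣Z-1∣≤ = begin
      ∣ Z - 1ℤ ∣                     ≡⟨ cong ∣_∣ (split Z m) ⟩
      ∣ (Z - m) + (m - 1ℤ) ∣         ≤⟨ ∣i+j∣≤∣i∣+∣j∣ (Z - m) (m - 1ℤ) ⟩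
      ∣ Z - m ∣ ℕ.+ ∣ m - 1ℤ ∣       ≤⟨ ℕP.+-mono-≤ ∣Z-m∣≤ (ℕP.≤-trans (∣i-j∣≤∣i∣+∣j∣ m 1ℤ) (ℕP.+-monoˡ-≤ 1 ∣m∣≤)) ⟩
      ((U ℕ.+ 1) ℕ.+ (U ℕ.+ 1) ℕ.* (U ℕ.+ 1)) ℕ.+ (U ℕ.+ 1 ℕ.+ 1) ≡⟨ square U ⟩
      (U ℕ.+ 2) ℕ.* (U ℕ.+ 2)         ∎
  forced-square m n Z .(- (m * Z)) U 2≤U ∣m∣≤ ∣n∣≤ m≢0 large _ Z-1∣x-m (inj₂ refl) =
    ⊥-elim (quadratic-gap U ∣ Z - 1ℤ ∣ 2≤U large ∣Z-1∣≤)
    where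
    rearrange : ∀ m Z → (- m) * (Z - 1ℤ) - (- (m * Z) - m) ≡ + 2 * m
    rearrange = solve-∀
    Z-1∣2m : Z - 1ℤ ∣ + 2 * m
    Z-1∣2m = subst (λ k → Z - 1ℤ ∣ k) (rearrange m Z)
               (∣-sub {Z - 1ℤ} ((- m) * (Z - 1ℤ)) (- (m * Z) - m) (n∣m*n (- m) (Z - 1ℤ)) Z-1∣x-m)
    2m≢0 : + 2 * m ≢ 0ℤ
    2m≢0 2m≡0 = m≢0 (*-cancelˡ-≡ (+ 2) m 0ℤ 2m≡0)
    bound : ∀ U → 2 ℕ.* (U ℕ.+ 1) ℕ.+ (U ℕ.* U ℕ.+ 2 ℕ.* U ℕ.+ 2) ≡ (U ℕ.+ 2) ℕ.* (U ℕ.+ 2)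
    bound = ℕSolver.solve-∀
    ∣Z-1∣≤ : ∣ Z - 1ℤ ∣ ℕ.≤ (U ℕ.+ 2) ℕ.* (U ℕ.+ 2)
    ∣Z-1∣≤ = begin
      ∣ Z - 1ℤ ∣                ≤⟨ ∣-bound {Z - 1ℤ} Z-1∣2m 2m≢0 ⟩
      ∣ + 2 * m ∣               ≡⟨ abs-* (+ 2) m ⟩
      2 ℕ.* ∣ m ∣               ≤⟨ ℕP.*-monoʳ-≤ 2 ∣m∣≤ ⟩
      2 ℕ.* (U ℕ.+ 1)           ≤⟨ ℕP.m≤m+n _ _ ⟩
      2 ℕ.* (U ℕ.+ 1) ℕ.+ (U ℕ.* U ℕ.+ 2 ℕ.* U ℕ.+ 2) ≡⟨ bound U ⟩
      (U ℕ.+ 2) ℕ.* (U ℕ.+ 2)   ∎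


-- The content of θ-CO(m, n) with the auxiliary differences w₁, …, w₅, d eliminated.
record Witness (p : ℕ) (m n : ℤ) : Set where
  field
    u x′ Z x Y : ℤ
    u-power  : 1ℤ ∣[ p ] u
    u∈T      : InT u
    m∣u-1    : m ∣ u - 1ℤ
    n∣u-1    : n ∣ u - 1ℤ
    x′-power : (+ 8 * u + 1ℤ) ∣[ p ] x′
    u∣x′     : u ∣ x′
    Z-power  : 1ℤ ∣[ p ] Z
    Z∈T      : InT Z
    x′+1∣Z-1 : x′ + 1ℤ ∣ Z - 1ℤ
    x-power  : m ∣[ p ] x
    Z∣x      : Z ∣ x
    Y-power  : 1ℤ ∣[ p ] Y
    Z∣Y      : Z ∣ Y
    Y+Z∈T    : InT (Y + Z)
    Y-Z∈T    : InT (Y - Z)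
    x∣Y-Z    : x ∣ Y - Z
    Z-m∣n-x  : Z - m ∣ n - x
    Z-1∣x-m  : Z - 1ℤ ∣ x - m

module _ {p : ℕ} {m n : ℤ} where

  eightfold : ∀ u → (((((((u + u) + u) + u) + u) + u) + u) + u) + 1ℤ ≡ + 8 * u + 1ℤ
  eightfold = solve-∀

  sat⇒witness : Sat p (env2 m n) θ-CO → Witness p m n
  sat⇒witness (u , x′ , Z , x , Y , w₁ , w₂ , w₃ , d , w₄ , w₅ ,
               u-power , u∈T , u≡w₁+1 , m∣w₁ , n∣w₁ , x′-power , u∣x′ ,
               Z-power , Z∈T , Z≡w₂+1 , x′+1∣w₂ , x-power , Z∣x ,
               Y-power , Z∣Y , Y≡w₃+Z , Y+Z∈T , w₃∈T , x∣w₃ ,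
               Z≡d+m , n≡w₄+x , d∣w₄ , x≡w₅+m , w₂∣w₅) = record
    { u = u ; x′ = x′ ; Z = Z ; x = x ; Y = Y
    ; u-power  = u-power
    ; u∈T      = u∈T
    ; m∣u-1    = subst (λ k → m ∣ k) (sym (≡+⇒-≡ w₁ 1ℤ u≡w₁+1)) m∣w₁
    ; n∣u-1    = subst (λ k → n ∣ k) (sym (≡+⇒-≡ w₁ 1ℤ u≡w₁+1)) n∣w₁
    ; x′-power = subst (λ a → a ∣[ p ] x′) (eightfold u) x′-power
    ; u∣x′     = u∣x′
    ; Z-power  = Z-power
    ; Z∈T      = Z∈T
    ; x′+1∣Z-1 = subst (λ k → x′ + 1ℤ ∣ k) (sym (≡+⇒-≡ w₂ 1ℤ Z≡w₂+1)) x′+1∣w₂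
    ; x-power  = x-power
    ; Z∣x      = Z∣x
    ; Y-power  = Y-power
    ; Z∣Y      = Z∣Y
    ; Y+Z∈T    = Y+Z∈T
    ; Y-Z∈T    = subst InT (sym (≡+⇒-≡ w₃ Z Y≡w₃+Z)) w₃∈T
    ; x∣Y-Z    = subst (λ k → x ∣ k) (sym (≡+⇒-≡ w₃ Z Y≡w₃+Z)) x∣w₃
    ; Z-m∣n-x  = subst₂ _∣_ (sym (≡+⇒-≡ d m Z≡d+m)) (sym (≡+⇒-≡ w₄ x n≡w₄+x)) d∣w₄
    ; Z-1∣x-m  = subst₂ _∣_ (sym (≡+⇒-≡ w₂ 1ℤ Z≡w₂+1)) (sym (≡+⇒-≡ w₅ m x≡w₅+m)) w₂∣w₅
    }

  witness⇒sat : Witness p m n → Sat p (env2 m n) θ-CO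
  witness⇒sat w =
    u , x′ , Z , x , Y , u - 1ℤ , Z - 1ℤ , Y - Z , Z - m , n - x , x - m ,
    u-power , u∈T , -+-cancel u 1ℤ , m∣u-1 , n∣u-1 ,
    subst (λ a → a ∣[ p ] x′) (sym (eightfold u)) x′-power , u∣x′ ,
    Z-power , Z∈T , -+-cancel Z 1ℤ , x′+1∣Z-1 , x-power , Z∣x ,
    Y-power , Z∣Y , -+-cancel Y Z , Y+Z∈T , Y-Z∈T , x∣Y-Z ,
    -+-cancel Z m , -+-cancel n x , Z-m∣n-x , -+-cancel x m , Z-1∣x-m
    where open Witness w

module Correctness {p : ℕ} (p-prime : Prime p) where
  open PrimePowers p-prime
  open PowerRelation p
  open PrimePowerRelation p-prime
  open Gadgets p-prime

  witness⇒square : ∀ {m n} → Witness p m n → ¬ (+ p ∣ m) × ¬ (+ p ∣ n) × n ≡ m * m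
  witness⇒square {m} {n} w with proper-power u-power u∈T | proper-power Z-power Z∈T
    where open Witness w
  ... | s , 1≤s , ∣u∣≡p^s | r , 1≤r , ∣Z∣≡p^r =
    p∤m , p∤n ,
    forced-square m n Z x ∣ u ∣ (InT⇒2≤∣∣ u∈T) ∣m∣≤ ∣n∣≤ m≢0
      (multiple-is-large u x′ (Z - 1ℤ) s ∣u∣≡p^s 1≤s x′-power u∣x′ x′+1∣Z-1 (InT⇒pred≢0 Z∈T))
      Z-m∣n-x Z-1∣x-m x≡±mZ
    where
    open Witness w
    p∣u : p ℕD.∣ ∣ u ∣
    p∣u = subst (p ℕD.∣_) (sym ∣u∣≡p^s) (p∣p^s 1≤s)
    p∤m = p∤divisor-of-pred u m p∣u m∣u-1
    p∤n = p∤divisor-of-pred u n p∣u n∣u-1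
    ∣m∣≤ = divisor-of-pred-bound u m u∈T m∣u-1
    ∣n∣≤ = divisor-of-pred-bound u n u∈T n∣u-1
    m≢0 : m ≢ 0ℤ
    m≢0 refl = p∤m (p ℕD.∣0)
    x≡±mZ : x ≡± m * Z
    x≡±mZ = exact-multiple m x Z r ∣Z∣≡p^r 1≤r p∤m x-power Z∣x
              (power-gap Z Y x r ∣Z∣≡p^r Y-power Z∣Y (InT⇒≢0 Y+Z∈T) (InT⇒≢0 Y-Z∈T) x∣Y-Z)

  -- Completeness: for p ∤ m and n = m² a witness is u = p^s, x′ = (8u+1)u, Z = p^r,
  -- x = mZ and Y = Z·p^j, where s, r, j are multiplicative orders of p modulo n,
  -- x′ + 1 and m respectively.
  u-of : ℕ → ℤ
  u-of s = (+ p) ^ s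

  x′-of : ℕ → ℤ
  x′-of s = (+ 8 * u-of s + 1ℤ) * u-of s

  p∣u-of : ∀ s → 1 ℕ.≤ s → p ℕD.∣ ∣ u-of s ∣
  p∣u-of s 1≤s = subst (p ℕD.∣_) (sym (∣p^s∣ s)) (p∣p^s 1≤s)

  p∤x′-of+1 : ∀ s → 1 ℕ.≤ s → ¬ (+ p ∣ x′-of s + 1ℤ)
  p∤x′-of+1 s 1≤s = no-consecutive (x′-of s) (ℕD.∣-trans (p∣u-of s 1≤s) (n∣m*n (+ 8 * u-of s + 1ℤ) (u-of s)))

  witness-from-orders : ∀ {m n} → n ≡ m * m → ∀ s → 1 ℕ.≤ s → n ∣ u-of s - 1ℤ →
    Σ[ r ∈ ℕ ] 1 ℕ.≤ r × x′-of s + 1ℤ ∣ (+ p) ^ r - 1ℤ →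
    Σ[ j ∈ ℕ ] 1 ℕ.≤ j × m ∣ (+ p) ^ j - 1ℤ → Witness p m n
  witness-from-orders {m} {n} n≡m² s 1≤s n∣u-1 (r , 1≤r , x′+1∣Z-1) (j , 1≤j , m∣P-1) = record
    { u = u ; x′ = x′ ; Z = Z ; x = m * Z ; Y = Z * P
    ; u-power  = s , inj₁ (sym (*-identityˡ u))
    ; u∈T      = power-InT 1≤s
    ; m∣u-1    = ℕD.∣-trans (subst (λ k → m ∣ k) (sym n≡m²) (m∣m*n m m)) n∣u-1
    ; n∣u-1    = n∣u-1
    ; x′-power = s , inj₁ refl
    ; u∣x′     = n∣m*n (+ 8 * u + 1ℤ) u
    ; Z-power  = r , inj₁ (sym (*-identityˡ Z))
    ; Z∈T      = power-InT 1≤r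
    ; x′+1∣Z-1 = x′+1∣Z-1
    ; x-power  = r , inj₁ refl
    ; Z∣x      = n∣m*n m Z
    ; Y-power  = r ℕ.+ j , inj₁ (trans (sym (^-distribˡ-+-* (+ p) r j)) (sym (*-identityˡ _)))
    ; Z∣Y      = m∣m*n Z P
    ; Y+Z∈T    = subst InT (Z[P+1] Z P) (InT-* (power-InT 1≤r) (InT⇒suc≢0 (power-InT 1≤j)))
    ; Y-Z∈T    = subst InT (Z[P-1] Z P) (InT-* (power-InT 1≤r) (InT⇒pred≢0 (power-InT 1≤j)))
    ; x∣Y-Z    = subst (λ k → m * Z ∣ k) (trans (*-comm (P - 1ℤ) Z) (Z[P-1] Z P)) (*-monoˡ-∣ Z {m} {P - 1ℤ} m∣P-1)
    ; Z-m∣n-x  = subst (λ k → Z - m ∣ k) (trans (-m[Z-m] m Z) (cong (_- m * Z) (sym n≡m²))) (n∣m*n (- m) (Z - m))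
    ; Z-1∣x-m  = subst (λ k → Z - 1ℤ ∣ k) (m[Z-1] m Z) (n∣m*n m (Z - 1ℤ))
    }
    where
    u = u-of s
    x′ = x′-of s
    Z = (+ p) ^ r
    P = (+ p) ^ j
    Z[P+1] : ∀ Z P → Z * (P + 1ℤ) ≡ Z * P + Z
    Z[P+1] = solve-∀
    Z[P-1] : ∀ Z P → Z * (P - 1ℤ) ≡ Z * P - Z
    Z[P-1] = solve-∀
    -m[Z-m] : ∀ m Z → (- m) * (Z - m) ≡ m * m - m * Z
    -m[Z-m] = solve-∀
    m[Z-1] : ∀ m Z → m * (Z - 1ℤ) ≡ m * Z - m
    m[Z-1] = solve-∀

  square⇒witness : ∀ {m n} → ¬ (+ p ∣ m) → ¬ (+ p ∣ n) → n ≡ m * m → Witness p m n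
  square⇒witness {m} {n} p∤m p∤n n≡m² with order n p∤n
  ... | s , 1≤s , n∣u-1 = witness-from-orders n≡m² s 1≤s n∣u-1
                            (order (x′-of s + 1ℤ) (p∤x′-of+1 s 1≤s)) (order m p∤m)

lemma4p11 : Σ (PEFormula 2) λ θ → (p : ℕ) → Prime p → (m n : ℤ) →
    Sat p (env2 m n) θ ⇔ (¬ ((+ p) ∣ m) × ¬ ((+ p) ∣ n) × n ≡ m * m)
lemma4p11 = θ-CO , λ p p-prime m n → let open Correctness p-prime in
  mk⇔ (λ sat → witness⇒square (sat⇒witness sat))
      (λ (p∤m , p∤n , n≡m²) → witness⇒sat (square⇒witness p∤m p∤n n≡m²))
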